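{- Let $G$ be a bridgeless graph with $m$ edges having vertices $v_1$ and $v_2$ joined by $k\ge 2$ parallel edges. Suppose that the degree of $v_1$ is at least $k+1$, the degree of $v_2$ is at least $k+2$, and the graph $G'$ obtained by contracting all the edges between $v_1$ and $v_2$ has a cycle cover with three cycles of total length at most $44(m-k)/27$. Then $G$ has a cycle cover with three cycles of total length at most $44m/27$.
   Context: Graphs may have loops and parallel edges. Contracting an edge $e$ identifies its end-vertices, removes $e$, and keeps all other edges (including new loops and parallel edges); contracting a loop means deleting it. Thus contracting all $k$ edges between $v_1$ and $v_2$ identifies $v_1$ and $v_2$ and removes these $k$ edges. A cycle is a subgraph with all degrees even (possibly empty). A cycle cover is a collection of cycles such that every edge lies in at least one of them; its (total) length is the sum of the numbers of edges of its cycles. A graph is bridgeless if it has no edge-cut of size one. -}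

module Defs where

open import Data.Nat using (ℕ; zero; suc; _+_; _*_; _≤_)
open import Data.Nat.Divisibility using (_∣_)
open import Data.Bool using (Bool; true; false; if_then_else_; _∧_; _∨_; not; _xor_)
open import Data.Fin using (Fin; zero; suc; punchOut; _≟_)
open import Data.List using (List; []; _∷_; length; lookup; map; filterᵇ)
open import Data.Product using (_×_; _,_; Σ-syntax)
open import Relation.Nullary using (yes; no; does)
open import Relation.Binary.PropositionalEquality using (_≡_; _≢_; sym)
open import Function using (_∘_)

-- Edges are identified by their position Fin (length G) in the list,
-- so parallel edges are distinct edges.
Graph : ℕ → Set
Graph n = List (Fin n × Fin n)

∣E∣ : ∀ {n} → Graph n → ℕ
∣E∣ = length

Edge : ∀ {n} → Graph n → Set
Edge G = Fin (length G)

EdgeSet : ∀ {n} → Graph n → Set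
EdgeSet G = Edge G → Bool

∑ : ∀ {m} → (Fin m → ℕ) → ℕ
∑ {zero}  f = 0
∑ {suc m} f = f zero + ∑ (f ∘ suc)

_==_ : ∀ {n} → Fin n → Fin n → Bool
a == b = does (a ≟ b)

b2n : Bool → ℕ
b2n true  = 1
b2n false = 0

-- number of ends of the edge (a , b) at v (a loop at v counts twice)
incid : ∀ {n} → Fin n → Fin n × Fin n → ℕ
incid v (a , b) = b2n (a == v) + b2n (b == v)

degIn : ∀ {n} (G : Graph n) → EdgeSet G → Fin n → ℕ
degIn G S v = ∑ (λ e → if S e then incid v (lookup G e) else 0)

deg : ∀ {n} (G : Graph n) → Fin n → ℕ
deg G v = degIn G (λ _ → true) v

size : ∀ {n} (G : Graph n) → EdgeSet G → ℕ
size G S = ∑ (λ e → b2n (S e))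

IsCycle : ∀ {n} (G : Graph n) → EdgeSet G → Set
IsCycle G S = ∀ v → 2 ∣ degIn G S v

cutSize : ∀ {n} (G : Graph n) → (Fin n → Bool) → ℕ
cutSize G X = ∑ (λ e → crosses (lookup G e))
  where
  crosses : _ → ℕ
  crosses (a , b) = b2n (X a xor X b)

Bridgeless : ∀ {n} → Graph n → Set
Bridgeless {n} G = ∀ (X : Fin n → Bool) → cutSize G X ≢ 1

-- G has a cycle cover consisting of three cycles C₁ C₂ C₃ whose total
-- length L satisfies 27 * L ≤ N   (i.e. L ≤ N / 27)
HasCC3 : ∀ {n} → Graph n → ℕ → Set
HasCC3 G N =
  Σ[ C₁ ∈ EdgeSet G ] Σ[ C₂ ∈ EdgeSet G ] Σ[ C₃ ∈ EdgeSet G ]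
    (IsCycle G C₁ × IsCycle G C₂ × IsCycle G C₃
    × (∀ e → (C₁ e ∨ C₂ e ∨ C₃ e) ≡ true)
    × 27 * (size G C₁ + size G C₂ + size G C₃) ≤ N)

between : ∀ {n} → Fin n → Fin n → Fin n × Fin n → Bool
between v₁ v₂ (a , b) = (a == v₁ ∧ b == v₂) ∨ (a == v₂ ∧ b == v₁)

mult : ∀ {n} → Graph n → Fin n → Fin n → ℕ
mult G v₁ v₂ = length (filterᵇ (between v₁ v₂) G)

-- identify v₂ with v₁: the vertex v₂ is deleted (Fin (suc n) → Fin n)
-- and its ends are redirected to v₁
merge : ∀ {n} (v₁ v₂ : Fin (suc n)) → v₁ ≢ v₂ → Fin (suc n) → Fin n
merge v₁ v₂ ne w with w ≟ v₂
... | yes _ = punchOut {i = v₂} {j = v₁} (ne ∘ sym)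
... | no p  = punchOut {i = v₂} {j = w} (p ∘ sym)

contractAll : ∀ {n} (G : Graph (suc n)) (v₁ v₂ : Fin (suc n)) → v₁ ≢ v₂ → Graph n
contractAll G v₁ v₂ ne =
  map (λ { (a , b) → (merge v₁ v₂ ne a , merge v₁ v₂ ne b) })
      (filterᵇ (not ∘ between v₁ v₂) G)

module Submission where

-- The edges of G' = G / (bundle) are exactly the non-bundle edges of G, so a
-- cycle C' of G' lifts to G as C' together with a set T of bundle edges.
-- Every vertex other than v₁, v₂ keeps its degree, and the degrees of v₁ and
-- v₂ in the lift are d₁ + |T| and d₂ + |T|, where d₁ + d₂ is the (even)
-- degree of the merged vertex in C'.  Hence the lift is a cycle as soon as
-- |T| ≡ d₁ (mod 2).  For three cycles we choose T₁, T₂, T₃ with prescribed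
-- parities, jointly covering the bundle, of total size at most k + 1
-- (a finite case analysis on the first two bundle edges).  The lifted cover
-- has length at most L' + k + 1, and 44(m - k) + 27(k + 1) ≤ 44m for k ≥ 2.

open import Defs
open import Data.Bool using (Bool; true; false; if_then_else_; not; _∧_; _∨_; _xor_)
open import Data.Bool.Properties using (xor-assoc; xor-same; xor-identityʳ; not-distribˡ-xor; not-involutive)
open import Data.Fin using (Fin; zero; suc; _≟_; punchOut)
open import Data.Fin.Properties using (punchOut-cong; punchOut-injective)
open import Data.List using (List; []; _∷_; length; lookup; map; filterᵇ)
open import Data.Nat using (ℕ; zero; suc; _+_; _*_; _∸_; _≤_; z≤n; s≤s)
open import Data.Nat.Divisibility using (_∣_; divides)
open import Data.Nat.Properties
  using (+-assoc; +-comm; +-suc; +-identityʳ; *-identityʳ; *-zeroʳ; *-distribˡ-+; *-monoʳ-≤;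
         +-mono-≤; +-monoˡ-≤; +-monoʳ-≤; m≤m+n; m≤n+m; m∸n+n≡m; ≤-trans; module ≤-Reasoning)
open import Data.Nat.Tactic.RingSolver using (solve-∀)
open import Data.Product using (_×_; _,_)
open import Data.Sum using (_⊎_; inj₁; inj₂)
open import Function using (_∘_)
open import Relation.Nullary using (Dec; yes; no; contradiction)
open import Relation.Nullary.Decidable using (dec-true; dec-false)
open import Relation.Binary.PropositionalEquality

∑-cong : ∀ {m} {f g : Fin m → ℕ} → (∀ i → f i ≡ g i) → ∑ f ≡ ∑ g
∑-cong {zero}  _  = refl
∑-cong {suc m} eq = cong₂ _+_ (eq zero) (∑-cong (eq ∘ suc))

∑-+ : ∀ {m} (f g : Fin m → ℕ) → ∑ (λ i → f i + g i) ≡ ∑ f + ∑ g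
∑-+ {zero}  f g = refl
∑-+ {suc m} f g = begin
  f zero + g zero + ∑ (λ i → f (suc i) + g (suc i)) ≡⟨ cong (f zero + g zero +_) (∑-+ (f ∘ suc) (g ∘ suc)) ⟩
  f zero + g zero + (∑ (f ∘ suc) + ∑ (g ∘ suc))       ≡⟨ regroup (f zero) (g zero) (∑ (f ∘ suc)) (∑ (g ∘ suc)) ⟩
  f zero + ∑ (f ∘ suc) + (g zero + ∑ (g ∘ suc))       ∎
  where
  open ≡-Reasoning
  regroup : ∀ a b c d → a + b + (c + d) ≡ a + c + (b + d)
  regroup = solve-∀

count : ∀ {m} → (Fin m → Bool) → ℕ
count S = ∑ (b2n ∘ S)

count-const : ∀ m b → count {m} (λ _ → b) ≡ m * b2n b
count-const zero    b = refl
count-const (suc m) b = cong (b2n b +_) (count-const m b)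

∑-if-const : ∀ {m} (S : Fin m → Bool) c → ∑ (λ i → if S i then c else 0) ≡ count S * c
∑-if-const {zero}  S c = refl
∑-if-const {suc m} S c with S zero
... | true  = cong (c +_) (∑-if-const (S ∘ suc) c)
... | false = ∑-if-const (S ∘ suc) c

-- Parity, as a Boolean valued homomorphism (ℕ, +) → (Bool, xor)

odd : ℕ → Bool
odd zero    = false
odd (suc n) = not (odd n)

odd-+ : ∀ a b → odd (a + b) ≡ odd a xor odd b
odd-+ zero    b = refl
odd-+ (suc a) b = trans (cong not (odd-+ a b)) (not-distribˡ-xor (odd a) (odd b))

odd-b2n : ∀ b → odd (b2n b) ≡ b
odd-b2n true  = refl
odd-b2n false = refl

even⇒2∣ : ∀ n → odd n ≡ false → 2 ∣ n
even⇒2∣ zero          _ = divides 0 refl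
even⇒2∣ (suc (suc n)) e with even⇒2∣ n (trans (sym (not-involutive (odd n))) e)
... | divides q eq = divides (suc q) (cong (λ z → suc (suc z)) eq)

2∣⇒even : ∀ n → 2 ∣ n → odd n ≡ false
2∣⇒even n (divides q refl) = twice q
  where
  twice : ∀ q → odd (q * 2) ≡ false
  twice zero    = refl
  twice (suc q) = trans (not-involutive (odd (q * 2))) (twice q)

2∣-+ : ∀ a b → odd a ≡ odd b → 2 ∣ a + b
2∣-+ a b e = even⇒2∣ (a + b) (trans (odd-+ a b) (trans (cong (_xor odd b) e) (xor-same (odd b))))

2∣-+⁻¹ : ∀ a b → 2 ∣ a + b → odd a ≡ odd b
2∣-+⁻¹ a b d = xor-false (odd a) (odd b) (trans (sym (odd-+ a b)) (2∣⇒even (a + b) d))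
  where
  xor-false : ∀ x y → x xor y ≡ false → x ≡ y
  xor-false true  true  _ = refl
  xor-false false false _ = refl

xor-rebalance : ∀ a b t r → a xor b ≡ r xor t → a xor (b xor t) ≡ r
xor-rebalance a b t r e = begin
  a xor (b xor t)  ≡⟨ sym (xor-assoc a b t) ⟩
  (a xor b) xor t  ≡⟨ cong (_xor t) e ⟩
  (r xor t) xor t  ≡⟨ xor-assoc r t t ⟩
  r xor (t xor t)  ≡⟨ cong (r xor_) (xor-same t) ⟩
  r xor false      ≡⟨ xor-identityʳ r ⟩
  r                ∎
  where open ≡-Reasoning

-- Weighted sums over a subset of the positions of a list
-- (degIn G S v is weight G S (incid v))

weight : {X : Set} (xs : List X) → (Fin (length xs) → Bool) → (X → ℕ) → ℕ
weight xs S h = ∑ (λ e → if S e then h (lookup xs e) else 0)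

weight-+ : ∀ {X : Set} (xs : List X) S (h₁ h₂ : X → ℕ)
         → weight xs S (λ x → h₁ x + h₂ x) ≡ weight xs S h₁ + weight xs S h₂
weight-+ xs S h₁ h₂ =
  trans (∑-cong split) (∑-+ (λ e → if S e then h₁ (lookup xs e) else 0) (λ e → if S e then h₂ (lookup xs e) else 0))
  where
  split : ∀ e → (if S e then h₁ (lookup xs e) + h₂ (lookup xs e) else 0)
              ≡ (if S e then h₁ (lookup xs e) else 0) + (if S e then h₂ (lookup xs e) else 0)
  split e with S e
  ... | true  = refl
  ... | false = refl

count-weight : ∀ {X : Set} (xs : List X) S → count S ≡ weight xs S (λ _ → 1)
count-weight xs S = sym (trans (∑-if-const S 1) (*-identityʳ (count S)))

-- Splitting a list into the elements failing and satisfying p; a subset of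
-- the list is assembled from a subset of each part.
module Split {A : Set} (p : A → Bool) where

  combine : (xs : List A) → (Fin (length (filterᵇ (not ∘ p) xs)) → Bool)
          → (Fin (length (filterᵇ p xs)) → Bool) → Fin (length xs) → Bool
  combine (x ∷ xs) S T i with p x
  combine (x ∷ xs) S T zero    | true  = T zero
  combine (x ∷ xs) S T (suc i) | true  = combine xs S (T ∘ suc) i
  combine (x ∷ xs) S T zero    | false = S zero
  combine (x ∷ xs) S T (suc i) | false = combine xs (S ∘ suc) T i

  weight-combine : ∀ xs S T h
    → weight xs (combine xs S T) h ≡ weight (filterᵇ (not ∘ p) xs) S h + weight (filterᵇ p xs) T h
  weight-combine []       S T h = refl
  weight-combine (x ∷ xs) S T h with p x
  ... | true  = trans (cong (hx +_) (weight-combine xs S (T ∘ suc) h))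
                      (swap hx (weight (filterᵇ (not ∘ p) xs) S h) (weight (filterᵇ p xs) (T ∘ suc) h))
    where
    hx = if T zero then h x else 0
    swap : ∀ a b c → a + (b + c) ≡ b + (a + c)
    swap = solve-∀
  ... | false = trans (cong (hx +_) (weight-combine xs (S ∘ suc) T h))
                      (sym (+-assoc hx (weight (filterᵇ (not ∘ p) xs) (S ∘ suc) h) (weight (filterᵇ p xs) T h)))
    where hx = if S zero then h x else 0

  weight-congᵖ : ∀ xs T (h₁ h₂ : A → ℕ) → (∀ x → p x ≡ true → h₁ x ≡ h₂ x)
               → weight (filterᵇ p xs) T h₁ ≡ weight (filterᵇ p xs) T h₂
  weight-congᵖ []       T h₁ h₂ eq = refl
  weight-congᵖ (x ∷ xs) T h₁ h₂ eq with p x in px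
  ... | true  = cong₂ _+_ (cong (λ z → if T zero then z else 0) (eq x px)) (weight-congᵖ xs (T ∘ suc) h₁ h₂ eq)
  ... | false = weight-congᵖ xs T h₁ h₂ eq

  weight-cong¬ᵖ : ∀ xs S (h₁ h₂ : A → ℕ) → (∀ x → p x ≡ false → h₁ x ≡ h₂ x)
                → weight (filterᵇ (not ∘ p) xs) S h₁ ≡ weight (filterᵇ (not ∘ p) xs) S h₂
  weight-cong¬ᵖ []       S h₁ h₂ eq = refl
  weight-cong¬ᵖ (x ∷ xs) S h₁ h₂ eq with p x in px
  ... | false = cong₂ _+_ (cong (λ z → if S zero then z else 0) (eq x px)) (weight-cong¬ᵖ xs (S ∘ suc) h₁ h₂ eq)
  ... | true  = weight-cong¬ᵖ xs S h₁ h₂ eq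

  length-split : ∀ xs → length xs ≡ length (filterᵇ (not ∘ p) xs) + length (filterᵇ p xs)
  length-split []       = refl
  length-split (x ∷ xs) with p x
  ... | true  = trans (cong suc (length-split xs)) (sym (+-suc _ _))
  ... | false = cong suc (length-split xs)

  combine-cover : ∀ xs S₁ S₂ S₃ T₁ T₂ T₃
    → (∀ i → (S₁ i ∨ S₂ i ∨ S₃ i) ≡ true) → (∀ j → (T₁ j ∨ T₂ j ∨ T₃ j) ≡ true)
    → ∀ e → (combine xs S₁ T₁ e ∨ combine xs S₂ T₂ e ∨ combine xs S₃ T₃ e) ≡ true
  combine-cover (x ∷ xs) S₁ S₂ S₃ T₁ T₂ T₃ cs ct e with p x
  combine-cover (x ∷ xs) S₁ S₂ S₃ T₁ T₂ T₃ cs ct zero    | true  = ct zero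
  combine-cover (x ∷ xs) S₁ S₂ S₃ T₁ T₂ T₃ cs ct (suc i) | true  =
    combine-cover xs S₁ S₂ S₃ (T₁ ∘ suc) (T₂ ∘ suc) (T₃ ∘ suc) cs (ct ∘ suc) i
  combine-cover (x ∷ xs) S₁ S₂ S₃ T₁ T₂ T₃ cs ct zero    | false = cs zero
  combine-cover (x ∷ xs) S₁ S₂ S₃ T₁ T₂ T₃ cs ct (suc i) | false =
    combine-cover xs (S₁ ∘ suc) (S₂ ∘ suc) (S₃ ∘ suc) T₁ T₂ T₃ (cs ∘ suc) ct i

module Map {A B : Set} (g : A → B) where

  reindex : (ys : List A) → Fin (length ys) → Fin (length (map g ys))
  reindex (y ∷ ys) zero    = zero
  reindex (y ∷ ys) (suc i) = suc (reindex ys i)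

  weight-map : ∀ ys S (h : B → ℕ) → weight (map g ys) S h ≡ weight ys (S ∘ reindex ys) (h ∘ g)
  weight-map []       S h = refl
  weight-map (y ∷ ys) S h = cong ((if S zero then h (g y) else 0) +_) (weight-map ys (S ∘ suc) h)

-- Choosing three subsets of a bundle of m ≥ 2 edges with prescribed
-- parities that cover the bundle and have total size at most m + 1

pattern3 : ∀ {k} → Bool → Bool → Bool → Fin (suc (suc k)) → Bool
pattern3 a b c zero          = a
pattern3 a b c (suc zero)    = b
pattern3 a b c (suc (suc _)) = c

count-pattern3 : ∀ k a b c → count (pattern3 {k} a b c) ≡ b2n a + (b2n b + k * b2n c)
count-pattern3 k a b c = cong (λ z → b2n a + (b2n b + z)) (count-const k c)

odd-pattern3 : ∀ k a b c r → a xor b ≡ r xor odd (k * b2n c) → odd (count (pattern3 {k} a b c)) ≡ r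
odd-pattern3 k a b c r e = begin
  odd (count (pattern3 {k} a b c))              ≡⟨ cong odd (count-pattern3 k a b c) ⟩
  odd (b2n a + (b2n b + k * b2n c))             ≡⟨ odd-+ (b2n a) _ ⟩
  odd (b2n a) xor odd (b2n b + k * b2n c)       ≡⟨ cong (odd (b2n a) xor_) (odd-+ (b2n b) _) ⟩
  odd (b2n a) xor (odd (b2n b) xor odd (k * b2n c))
    ≡⟨ cong₂ (λ x y → x xor (y xor odd (k * b2n c))) (odd-b2n a) (odd-b2n b) ⟩
  a xor (b xor odd (k * b2n c))                 ≡⟨ xor-rebalance a b _ r e ⟩
  r                                             ∎
  where open ≡-Reasoning

-- How three subsets meet the first two edges: xᵢ, yᵢ say whether the i-th
-- subset contains the first / second edge.
record PairChoice (s₁ s₂ s₃ : Bool) : Set where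
  constructor choice
  field
    x₁ y₁ x₂ y₂ x₃ y₃ : Bool
    parity₁ : x₁ xor y₁ ≡ s₁
    parity₂ : x₂ xor y₂ ≡ s₂
    parity₃ : x₃ xor y₃ ≡ s₃
    covers-first  : (x₁ ∨ x₂ ∨ x₃) ≡ true
    covers-second : (y₁ ∨ y₂ ∨ y₃) ≡ true
    cost : b2n x₁ + b2n y₁ + (b2n x₂ + b2n y₂) + (b2n x₃ + b2n y₃) ≤ 3

pairChoice : ∀ s₁ s₂ s₃ → PairChoice s₁ s₂ s₃
pairChoice false false false = choice true  true  false false false false refl refl refl refl refl (s≤s (s≤s z≤n))
pairChoice false false true  = choice true  true  false false true  false refl refl refl refl refl (s≤s (s≤s (s≤s z≤n)))
pairChoice false true  false = choice true  true  true  false false false refl refl refl refl refl (s≤s (s≤s (s≤s z≤n)))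
pairChoice true  false false = choice true  false true  true  false false refl refl refl refl refl (s≤s (s≤s (s≤s z≤n)))
pairChoice false true  true  = choice false false true  false false true  refl refl refl refl refl (s≤s (s≤s z≤n))
pairChoice true  false true  = choice true  false false false false true  refl refl refl refl refl (s≤s (s≤s z≤n))
pairChoice true  true  false = choice true  false false true  false false refl refl refl refl refl (s≤s (s≤s z≤n))
pairChoice true  true  true  = choice true  false false true  true  false refl refl refl refl refl (s≤s (s≤s (s≤s z≤n)))

record BundleChoice (m : ℕ) (r₁ r₂ r₃ : Bool) : Set where
  field
    T₁ T₂ T₃ : Fin m → Bool
    odd₁ : odd (count T₁) ≡ r₁
    odd₂ : odd (count T₂) ≡ r₂
    odd₃ : odd (count T₃) ≡ r₃
    covers : ∀ j → (T₁ j ∨ T₂ j ∨ T₃ j) ≡ true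
    cost : count T₁ + count T₂ + count T₃ ≤ m + 1

-- on the first two edges use pairChoice (with parities corrected for the
-- remaining k edges); T₁ takes all remaining edges, T₂ and T₃ none of them
bundleChoice : ∀ m → 2 ≤ m → (r₁ r₂ r₃ : Bool) → BundleChoice m r₁ r₂ r₃
bundleChoice (suc (suc k)) (s≤s (s≤s _)) r₁ r₂ r₃ = record
  { T₁ = pattern3 x₁ y₁ true
  ; T₂ = pattern3 x₂ y₂ false
  ; T₃ = pattern3 x₃ y₃ false
  ; odd₁ = odd-pattern3 k x₁ y₁ true  r₁ parity₁
  ; odd₂ = odd-pattern3 k x₂ y₂ false r₂ parity₂
  ; odd₃ = odd-pattern3 k x₃ y₃ false r₃ parity₃
  ; covers = covers
  ; cost = cost′
  }
  where
  open PairChoice (pairChoice (r₁ xor odd (k * 1)) (r₂ xor odd (k * 0)) (r₃ xor odd (k * 0)))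
  covers : ∀ j → (pattern3 x₁ y₁ true j ∨ pattern3 x₂ y₂ false j ∨ pattern3 x₃ y₃ false j) ≡ true
  covers zero          = covers-first
  covers (suc zero)    = covers-second
  covers (suc (suc _)) = refl
  regroup : ∀ a b c d e f k
          → a + (b + k * 1) + (c + (d + k * 0)) + (e + (f + k * 0)) ≡ a + b + (c + d) + (e + f) + k
  regroup = solve-∀
  cost′ : count (pattern3 {k} x₁ y₁ true) + count (pattern3 {k} x₂ y₂ false) + count (pattern3 {k} x₃ y₃ false)
        ≤ suc (suc k) + 1
  cost′ rewrite count-pattern3 k x₁ y₁ true | count-pattern3 k x₂ y₂ false | count-pattern3 k x₃ y₃ false =
    subst₂ _≤_ (sym (regroup (b2n x₁) (b2n y₁) (b2n x₂) (b2n y₂) (b2n x₃) (b2n y₃) k))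
               (cong (λ z → suc (suc z)) (+-comm 1 k))
               (+-monoˡ-≤ k cost)

==-refl : ∀ {n} (a : Fin n) → a == a ≡ true
==-refl a = dec-true (a ≟ a) refl

==-≢ : ∀ {n} {a b : Fin n} → a ≢ b → a == b ≡ false
==-≢ {a = a} {b} = dec-false (a ≟ b)

∨-∧-true : ∀ x y z w → ((x ∧ y) ∨ (z ∧ w)) ≡ true → (x ≡ true × y ≡ true) ⊎ (z ≡ true × w ≡ true)
∨-∧-true true  true  _     _     _ = inj₁ (refl , refl)
∨-∧-true _     _     true  true  _ = inj₂ (refl , refl)
∨-∧-true true  false true  false ()
∨-∧-true true  false false _     ()
∨-∧-true false _     true  false ()
∨-∧-true false _     false _     ()

==⇒≡ : ∀ {n} (a b : Fin n) → a == b ≡ true → a ≡ b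
==⇒≡ a b e with a ≟ b
... | yes a≡b = a≡b
==⇒≡ a b () | no _

module Merging {n} (v₁ v₂ : Fin (suc n)) (ne : v₁ ≢ v₂) where

  μ : Fin (suc n) → Fin n
  μ = merge v₁ v₂ ne

  μ-v₂ : μ v₂ ≡ μ v₁
  μ-v₂ with v₂ ≟ v₂ | v₁ ≟ v₂
  ... | yes _ | no _  = punchOut-cong v₂ refl
  ... | no q  | _     = contradiction refl q
  ... | _     | yes e = contradiction e ne

  μ-other : ∀ w (q : w ≢ v₂) → μ w ≡ punchOut {i = v₂} {j = w} (q ∘ sym)
  μ-other w q with w ≟ v₂
  ... | yes e = contradiction e q
  ... | no _  = punchOut-cong v₂ refl

  μ-injective : ∀ a w → a ≢ v₂ → w ≢ v₂ → μ a ≡ μ w → a ≡ w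
  μ-injective a w qa qw e =
    punchOut-injective (qa ∘ sym) (qw ∘ sym) (trans (sym (μ-other a qa)) (trans e (μ-other w qw)))

  hits-merged : ∀ a → b2n (a == v₁) + b2n (a == v₂) ≡ b2n (μ a == μ v₁)
  hits-merged a = cases (a ≟ v₁) (a ≟ v₂)
    where
    cases : Dec (a ≡ v₁) → Dec (a ≡ v₂) → b2n (a == v₁) + b2n (a == v₂) ≡ b2n (μ a == μ v₁)
    cases (yes a≡v₁) _ rewrite a≡v₁ | ==-refl v₁ | ==-≢ ne | ==-refl (μ v₁) = refl
    cases (no a≢v₁) (yes a≡v₂) rewrite ==-≢ a≢v₁ | a≡v₂ | ==-refl v₂ | μ-v₂ | ==-refl (μ v₁) = refl
    cases (no a≢v₁) (no a≢v₂)
      rewrite ==-≢ a≢v₁ | ==-≢ a≢v₂ | ==-≢ (λ e → a≢v₁ (μ-injective a v₁ a≢v₂ ne e)) = refl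

  hits-other : ∀ w → w ≢ v₁ → w ≢ v₂ → ∀ a → b2n (a == w) ≡ b2n (μ a == μ w)
  hits-other w w≢v₁ w≢v₂ a = cases (a ≟ w) (a ≟ v₂)
    where
    cases : Dec (a ≡ w) → Dec (a ≡ v₂) → b2n (a == w) ≡ b2n (μ a == μ w)
    cases (yes a≡w) _ rewrite a≡w | ==-refl w | ==-refl (μ w) = refl
    cases (no a≢w) (yes a≡v₂)
      rewrite ==-≢ a≢w | a≡v₂ | μ-v₂ | ==-≢ (λ e → w≢v₁ (sym (μ-injective v₁ w ne w≢v₂ e))) = refl
    cases (no a≢w) (no a≢v₂) rewrite ==-≢ a≢w | ==-≢ (λ e → a≢w (μ-injective a w a≢v₂ w≢v₂ e)) = refl

  incid-merged : ∀ a b → incid v₁ (a , b) + incid v₂ (a , b) ≡ incid (μ v₁) (μ a , μ b)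
  incid-merged a b = trans (interchange (b2n (a == v₁)) (b2n (b == v₁)) (b2n (a == v₂)) (b2n (b == v₂)))
                           (cong₂ _+_ (hits-merged a) (hits-merged b))
    where
    interchange : ∀ x y z t → (x + y) + (z + t) ≡ (x + z) + (y + t)
    interchange = solve-∀

  incid-other : ∀ w → w ≢ v₁ → w ≢ v₂ → ∀ a b → incid w (a , b) ≡ incid (μ w) (μ a , μ b)
  incid-other w w≢v₁ w≢v₂ a b = cong₂ _+_ (hits-other w w≢v₁ w≢v₂ a) (hits-other w w≢v₁ w≢v₂ b)

  bundle-ends : ∀ a b → between v₁ v₂ (a , b) ≡ true → (a ≡ v₁ × b ≡ v₂) ⊎ (a ≡ v₂ × b ≡ v₁)
  bundle-ends a b e with ∨-∧-true (a == v₁) (b == v₂) (a == v₂) (b == v₁) e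
  ... | inj₁ (p , q) = inj₁ (==⇒≡ a v₁ p , ==⇒≡ b v₂ q)
  ... | inj₂ (p , q) = inj₂ (==⇒≡ a v₂ p , ==⇒≡ b v₁ q)

  incid-bundle : ∀ a b → between v₁ v₂ (a , b) ≡ true → ∀ w → incid w (a , b) ≡ incid w (v₁ , v₂)
  incid-bundle a b e w with bundle-ends a b e
  ... | inj₁ (refl , refl) = refl
  ... | inj₂ (refl , refl) = +-comm (b2n (v₂ == w)) (b2n (v₁ == w))

  incid-v₁ : incid v₁ (v₁ , v₂) ≡ 1
  incid-v₁ rewrite ==-refl v₁ | ==-≢ (ne ∘ sym) = refl

  incid-v₂ : incid v₂ (v₁ , v₂) ≡ 1
  incid-v₂ rewrite ==-≢ ne | ==-refl v₂ = refl

  incid-away : ∀ w → w ≢ v₁ → w ≢ v₂ → incid w (v₁ , v₂) ≡ 0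
  incid-away w w≢v₁ w≢v₂ rewrite ==-≢ (w≢v₁ ∘ sym) | ==-≢ (w≢v₂ ∘ sym) = refl

-- Lifting subgraphs of the contraction back to G

module Lift {n} (G : Graph (suc n)) (v₁ v₂ : Fin (suc n)) (ne : v₁ ≢ v₂) where
  open Merging v₁ v₂ ne
  open Split (between v₁ v₂)

  G′ : Graph n
  G′ = contractAll G v₁ v₂ ne

  μ₂ : Fin (suc n) × Fin (suc n) → Fin n × Fin n
  μ₂ (a , b) = (μ a , μ b)
  open Map μ₂

  -- the edges of G outside / inside the bundle; the former are the edges of G′
  rest bundle : Graph (suc n)
  rest   = filterᵇ (not ∘ between v₁ v₂) G
  bundle = filterᵇ (between v₁ v₂) G

  bundle≤edges : mult G v₁ v₂ ≤ ∣E∣ G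
  bundle≤edges = subst (length bundle ≤_) (sym (length-split G)) (m≤n+m (length bundle) (length rest))

  restrict : EdgeSet G′ → EdgeSet rest
  restrict C′ = C′ ∘ reindex rest

  lift : EdgeSet G′ → EdgeSet bundle → EdgeSet G
  lift C′ T = combine G (restrict C′) T

  restDeg : EdgeSet G′ → Fin (suc n) → ℕ
  restDeg C′ w = weight rest (restrict C′) (incid w)

  size-lift : ∀ C′ T → size G (lift C′ T) ≡ size G′ C′ + count T
  size-lift C′ T = begin
    count (lift C′ T)                                                ≡⟨ count-weight G (lift C′ T) ⟩
    weight G (lift C′ T) (λ _ → 1)                                   ≡⟨ weight-combine G (restrict C′) T (λ _ → 1) ⟩
    weight rest (restrict C′) (λ _ → 1) + weight bundle T (λ _ → 1)
      ≡⟨ cong₂ _+_ (sym (weight-map rest C′ (λ _ → 1))) (sym (count-weight bundle T)) ⟩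
    weight G′ C′ (λ _ → 1) + count T                                 ≡⟨ cong (_+ count T) (sym (count-weight G′ C′)) ⟩
    count C′ + count T                                               ∎
    where open ≡-Reasoning

  degree-lift : ∀ C′ T w → degIn G (lift C′ T) w ≡ restDeg C′ w + count T * incid w (v₁ , v₂)
  degree-lift C′ T w = trans (weight-combine G (restrict C′) T (incid w)) (cong (restDeg C′ w +_) bundle-part)
    where
    bundle-part : weight bundle T (incid w) ≡ count T * incid w (v₁ , v₂)
    bundle-part = trans (weight-congᵖ G T (incid w) (λ _ → incid w (v₁ , v₂)) (λ { (a , b) e → incid-bundle a b e w }))
                        (∑-if-const T (incid w (v₁ , v₂)))

  degree-lift-end : ∀ C′ T w → incid w (v₁ , v₂) ≡ 1 → degIn G (lift C′ T) w ≡ restDeg C′ w + count T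
  degree-lift-end C′ T w one =
    trans (degree-lift C′ T w) (cong (restDeg C′ w +_) (trans (cong (count T *_) one) (*-identityʳ (count T))))

  degree-lift-away : ∀ C′ T w → w ≢ v₁ → w ≢ v₂ → degIn G (lift C′ T) w ≡ degIn G′ C′ (μ w)
  degree-lift-away C′ T w w≢v₁ w≢v₂ = begin
    degIn G (lift C′ T) w              ≡⟨ degree-lift C′ T w ⟩
    restDeg C′ w + count T * incid w (v₁ , v₂)
      ≡⟨ cong (λ z → restDeg C′ w + count T * z) (incid-away w w≢v₁ w≢v₂) ⟩
    restDeg C′ w + count T * 0         ≡⟨ cong (restDeg C′ w +_) (*-zeroʳ (count T)) ⟩
    restDeg C′ w + 0                   ≡⟨ +-identityʳ (restDeg C′ w) ⟩
    restDeg C′ w                       ≡⟨ weight-cong¬ᵖ G (restrict C′) (incid w) _ (λ { (a , b) _ → incid-other w w≢v₁ w≢v₂ a b }) ⟩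
    weight rest (restrict C′) (incid (μ w) ∘ μ₂) ≡⟨ sym (weight-map rest C′ (incid (μ w))) ⟩
    degIn G′ C′ (μ w)                  ∎
    where open ≡-Reasoning

  restDeg-merged : ∀ C′ → restDeg C′ v₁ + restDeg C′ v₂ ≡ degIn G′ C′ (μ v₁)
  restDeg-merged C′ = begin
    restDeg C′ v₁ + restDeg C′ v₂                              ≡⟨ sym (weight-+ rest (restrict C′) (incid v₁) (incid v₂)) ⟩
    weight rest (restrict C′) (λ e → incid v₁ e + incid v₂ e)
      ≡⟨ weight-cong¬ᵖ G (restrict C′) _ _ (λ { (a , b) _ → incid-merged a b }) ⟩
    weight rest (restrict C′) (incid (μ v₁) ∘ μ₂)               ≡⟨ sym (weight-map rest C′ (incid (μ v₁))) ⟩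
    degIn G′ C′ (μ v₁)                                         ∎
    where open ≡-Reasoning

  -- parity of the non-bundle degree of v₁ in C′: the parity |T| must have
  target : EdgeSet G′ → Bool
  target C′ = odd (restDeg C′ v₁)

  lift-cycle : ∀ C′ T → IsCycle G′ C′ → odd (count T) ≡ target C′ → IsCycle G (lift C′ T)
  lift-cycle C′ T cyc par w = cases (w ≟ v₁) (w ≟ v₂)
    where
    parity-v₂ : odd (restDeg C′ v₁) ≡ odd (restDeg C′ v₂)
    parity-v₂ = 2∣-+⁻¹ (restDeg C′ v₁) (restDeg C′ v₂) (subst (2 ∣_) (sym (restDeg-merged C′)) (cyc (μ v₁)))
    cases : Dec (w ≡ v₁) → Dec (w ≡ v₂) → 2 ∣ degIn G (lift C′ T) w
    cases (yes refl) _ = subst (2 ∣_) (sym (degree-lift-end C′ T v₁ incid-v₁))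
                               (2∣-+ (restDeg C′ v₁) (count T) (sym par))
    cases (no _) (yes refl) = subst (2 ∣_) (sym (degree-lift-end C′ T v₂ incid-v₂))
                                    (2∣-+ (restDeg C′ v₂) (count T) (sym (trans par parity-v₂)))
    cases (no w≢v₁) (no w≢v₂) = subst (2 ∣_) (sym (degree-lift-away C′ T w w≢v₁ w≢v₂)) (cyc (μ w))

  lift-cover : ∀ N → 2 ≤ mult G v₁ v₂ → HasCC3 G′ N → HasCC3 G (N + 27 * (mult G v₁ v₂ + 1))
  lift-cover N bundle≥2 (C₁ , C₂ , C₃ , cyc₁ , cyc₂ , cyc₃ , cover , short) =
    lift C₁ T₁ , lift C₂ T₂ , lift C₃ T₃ ,
    lift-cycle C₁ T₁ cyc₁ odd₁ , lift-cycle C₂ T₂ cyc₂ odd₂ , lift-cycle C₃ T₃ cyc₃ odd₃ ,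
    combine-cover G (restrict C₁) (restrict C₂) (restrict C₃) T₁ T₂ T₃ (cover ∘ reindex rest) covers ,
    length-bound
    where
    open BundleChoice (bundleChoice (length bundle) bundle≥2 (target C₁) (target C₂) (target C₃))
    L′ = size G′ C₁ + size G′ C₂ + size G′ C₃
    added = count T₁ + count T₂ + count T₃
    regroup : ∀ a b c x y z → a + x + (b + y) + (c + z) ≡ a + b + c + (x + y + z)
    regroup = solve-∀
    sizes : size G (lift C₁ T₁) + size G (lift C₂ T₂) + size G (lift C₃ T₃) ≡ L′ + added
    sizes rewrite size-lift C₁ T₁ | size-lift C₂ T₂ | size-lift C₃ T₃ =
      regroup (size G′ C₁) (size G′ C₂) (size G′ C₃) (count T₁) (count T₂) (count T₃)
    length-bound : 27 * (size G (lift C₁ T₁) + size G (lift C₂ T₂) + size G (lift C₃ T₃))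
                 ≤ N + 27 * (length bundle + 1)
    length-bound = begin
      27 * (size G (lift C₁ T₁) + size G (lift C₂ T₂) + size G (lift C₃ T₃)) ≡⟨ cong (27 *_) sizes ⟩
      27 * (L′ + added)                    ≡⟨ *-distribˡ-+ 27 L′ added ⟩
      27 * L′ + 27 * added                 ≤⟨ +-mono-≤ short (*-monoʳ-≤ 27 cost) ⟩
      N + 27 * (length bundle + 1)         ∎
      where open ≤-Reasoning

budget : ∀ m k → 2 ≤ k → k ≤ m → 44 * (m ∸ k) + 27 * (k + 1) ≤ 44 * m
budget m k k≥2 k≤m = begin
  44 * (m ∸ k) + 27 * (k + 1)  ≤⟨ +-monoʳ-≤ (44 * (m ∸ k)) (bundle-cost k k≥2) ⟩
  44 * (m ∸ k) + 44 * k        ≡⟨ sym (*-distribˡ-+ 44 (m ∸ k) k) ⟩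
  44 * (m ∸ k + k)             ≡⟨ cong (44 *_) (m∸n+n≡m k≤m) ⟩
  44 * m                       ∎
  where
  open ≤-Reasoning
  -- 27(k + 1) ≤ 44k amounts to 27 ≤ 17k
  surplus : ∀ j → 27 * (2 + j + 1) + (17 * j + 7) ≡ 44 * (2 + j)
  surplus = solve-∀
  bundle-cost : ∀ b → 2 ≤ b → 27 * (b + 1) ≤ 44 * b
  bundle-cost (suc (suc j)) (s≤s (s≤s _)) = subst (27 * (2 + j + 1) ≤_) (surplus j) (m≤m+n _ (17 * j + 7))

HasCC3-mono : ∀ {n} (G : Graph n) {N N′} → N ≤ N′ → HasCC3 G N → HasCC3 G N′
HasCC3-mono G N≤N′ (C₁ , C₂ , C₃ , cyc₁ , cyc₂ , cyc₃ , cover , short) =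
  C₁ , C₂ , C₃ , cyc₁ , cyc₂ , cyc₃ , cover , ≤-trans short N≤N′

-- Lemma 20.
lemma20 : ∀ {n} (G : Graph (suc n)) (v₁ v₂ : Fin (suc n)) (ne : v₁ ≢ v₂) (k : ℕ)
          → Bridgeless G
          → k ≡ mult G v₁ v₂
          → 2 ≤ k
          → k + 1 ≤ deg G v₁
          → k + 2 ≤ deg G v₂
          → HasCC3 (contractAll G v₁ v₂ ne) (44 * (∣E∣ G ∸ k))
          → HasCC3 G (44 * ∣E∣ G)
lemma20 G v₁ v₂ ne k _ refl k≥2 _ _ cover′ =
  HasCC3-mono G (budget (∣E∣ G) k k≥2 bundle≤edges) (lift-cover (44 * (∣E∣ G ∸ k)) k≥2 cover′)
  where open Lift G v₁ v₂ ne
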